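{- Let $n\ge1$, $1\le i\le n$, $m\ge1$, $A\in B^{i,m}$ and $1\le s<i$. Then $\sum_{p=i}^{n}x^A(s,p)=\varphi_s(A)$.
   Context: $B^{i,m}$ is the set of arrays $A=(a_{p,q})$ of non-negative integers indexed by $1\le p\le i$, $i\le q\le n$, with $\sum_{r=1}^n a_{\beta(r)}\le m$ for every Dyck path $\beta$ (a sequence of positions $\beta(1)=(1,i),\dots,\beta(n)=(i,n)$ with $\beta(r+1)\in\{(a,b+1),(a+1,b)\}$ if $\beta(r)=(a,b)$); $a_{p,q}=0$ outside this range. For $\ell<i$ the crystal function $\varphi_\ell$ is: for $i\le p\le n$ let $U_p=\sum_{j=i}^p a_{\ell,j}+\sum_{j=p}^n a_{\ell+1,j}$ and let $p_-$ be the largest $p$ maximizing $U_p$; then $\varphi_\ell(A)=\sum_{j=p_- }^n a_{\ell+1,j}-\sum_{j=p_-+1}^n a_{\ell,j}$. For $1\le s<i\le r\le n$, the step path $p_{s,r}$ is the set of positions $(s,i),\dots,(s,r),(s+1,r),\dots,(s+1,n)$; $S^A(s,r)=\sum_{x\in p_{s,r}}a_x$, $M^A(s)=\max\{S^A(s,r):i\le r\le n\}$. Define $r^A(s,0)=i-1$ and recursively $r^A(s,k+1)=\max\{r>r^A(s,k): S^A(s,r)=\max\{S^A(s,p):r^A(s,k)<p\le n\}\}$, with $\ell^A(s)$ the index such that $r^A(s,\ell^A(s))=n$. Define $x^A(s,r)$, $i\le r\le n$: $x^A(s,r)=0$ if $r\notin\{r^A(s,1),\dots,r^A(s,\ell^A(s))\}$;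 $x^A(s,n)=a_{s+1,n}$; for $1\le k<\ell^A(s)$, $x^A(s,r^A(s,k))$ is determined recursively by $S^A(s,r^A(s,k+1))+\sum_{p=i}^{r^A(s,k)}x^A(s,p)=M^A(s)$. -}

module Defs where

open import Data.Nat using (ℕ; zero; suc; _+_; _∸_; _≤_; _<_; _⊔_; _≤ᵇ_)
open import Data.Bool using (if_then_else_)
open import Data.Integer as ℤ using (ℤ; +_)
open import Data.Product using (_×_; _,_)
open import Data.Sum using (_⊎_)
open import Relation.Binary.PropositionalEquality using (_≡_; _≢_)

-- An array: entries a_{p,q} = A p q (row p, column q).
Array : Set
Array = ℕ → ℕ → ℕ

sumFrom : (ℕ → ℕ) → ℕ → ℕ → ℕ
sumFrom f a zero    = 0
sumFrom f a (suc k) = f a + sumFrom f (suc a) k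

-- Σ_{r=a}^{b} f r   (empty, i.e. 0, when b < a)
Σℕ : ℕ → ℕ → (ℕ → ℕ) → ℕ
Σℕ a b f = sumFrom f a (suc b ∸ a)

sumFromℤ : (ℕ → ℤ) → ℕ → ℕ → ℤ
sumFromℤ f a zero    = + 0
sumFromℤ f a (suc k) = f a ℤ.+ sumFromℤ f (suc a) k

Σℤ : ℕ → ℕ → (ℕ → ℤ) → ℤ
Σℤ a b f = sumFromℤ f a (suc b ∸ a)

maxFrom : (ℕ → ℕ) → ℕ → ℕ → ℕ
maxFrom f a zero    = f a
maxFrom f a (suc k) = maxFrom f a k ⊔ f (a + suc k)

maxRange : ℕ → ℕ → (ℕ → ℕ) → ℕ
maxRange a b f = maxFrom f a (b ∸ a)

lastArgmaxFrom : (ℕ → ℕ) → ℕ → ℕ → ℕ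
lastArgmaxFrom f a zero    = a
lastArgmaxFrom f a (suc k) =
  let p = lastArgmaxFrom f a k
      q = a + suc k
  in if f p ≤ᵇ f q then q else p

lastArgmax : ℕ → ℕ → (ℕ → ℕ) → ℕ
lastArgmax a b f = lastArgmaxFrom f a (b ∸ a)

record DyckPath (n i : ℕ) (β : ℕ → ℕ × ℕ) : Set where
  field
    start : β 1 ≡ (1 , i)
    end   : β n ≡ (i , n)
    step  : ∀ r → 1 ≤ r → r < n →
            let (a , b) = β r in
            (β (suc r) ≡ (a , suc b)) ⊎ (β (suc r) ≡ (suc a , b))

entryAt : Array → ℕ × ℕ → ℕ
entryAt A (p , q) = A p q

record InB (n i m : ℕ) (A : Array) : Set where
  field
    zeroOutside : ∀ p q → (p ≡ 0 ⊎ i < p ⊎ q < i ⊎ n < q) → A p q ≡ 0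
    dyckBound   : ∀ β → DyckPath n i β → Σℕ 1 n (λ r → entryAt A (β r)) ≤ m

U : ℕ → ℕ → Array → ℕ → ℕ → ℕ
U n i A ℓ p = Σℕ i p (λ j → A ℓ j) + Σℕ p n (λ j → A (suc ℓ) j)

pMinus : ℕ → ℕ → Array → ℕ → ℕ
pMinus n i A ℓ = lastArgmax i n (U n i A ℓ)

φ : ℕ → ℕ → Array → ℕ → ℤ
φ n i A ℓ =
  let p₋ = pMinus n i A ℓ in
  (+ Σℕ p₋ n (λ j → A (suc ℓ) j)) ℤ.- (+ Σℕ (suc p₋) n (λ j → A ℓ j))

-- S^A(s,r) = sum over p_{s,r} = (s,i),...,(s,r),(s+1,r),...,(s+1,n)
S : ℕ → ℕ → Array → ℕ → ℕ → ℕ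
S n i A s r = Σℕ i r (λ j → A s j) + Σℕ r n (λ j → A (suc s) j)

M : ℕ → ℕ → Array → ℕ → ℕ
M n i A s = maxRange i n (S n i A s)

rA : ℕ → ℕ → Array → ℕ → ℕ → ℕ
rA n i A s zero    = i ∸ 1
rA n i A s (suc k) = lastArgmax (suc (rA n i A s k)) n (S n i A s)

-- x satisfies the defining conditions of x^A(s,·) on i ≤ r ≤ n,
-- where ℓ = ℓ^A(s) (r^A(s,ℓ) = n)
record IsXA (n i : ℕ) (A : Array) (s ℓ : ℕ) (x : ℕ → ℤ) : Set where
  field
    offSeq : ∀ r → i ≤ r → r ≤ n →
             (∀ k → 1 ≤ k → k ≤ ℓ → r ≢ rA n i A s k) → x r ≡ + 0
    atN    : x n ≡ + A (suc s) n
    recur  : ∀ k → 1 ≤ k → k < ℓ →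
             (+ S n i A s (rA n i A s (suc k))) ℤ.+ Σℤ i (rA n i A s k) x
               ≡ + M n i A s

-- Since U_ℓ is the step-path sum S^A(ℓ,·), p₋ is the last maximiser of S^A(s,·), so
-- φ_s(A) = M^A(s) − S^A(s,n) + a_{s+1,n}.  On the other side, x^A(s,·) vanishes strictly
-- between r^A(s,ℓ−1) and n and equals a_{s+1,n} at n, while its sum up to r^A(s,ℓ−1) is
-- M^A(s) − S^A(s,n) by the defining recursion at k = ℓ−1 (for ℓ = 1 the sum is empty and
-- r^A(s,1) = n forces M^A(s) = S^A(s,n)).

module Submission where

open import Defs
open import Data.Nat using (ℕ; _≤_; _<_)
open import Data.Integer using (ℤ)
open import Relation.Binary.PropositionalEquality using (_≡_)

open import Data.Bool using (true; false; T)
open import Data.Integer as ℤ using (+_)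
import Data.Integer.Properties as ℤ
open import Data.Integer.Tactic.RingSolver using (solve-∀)
open import Data.Nat using (zero; suc; _+_; _∸_; _≤ᵇ_; _≤′_; ≤′-refl; ≤′-step; z≤n; s≤s; z<s)
open import Data.Nat.Properties
open import Data.Sum using (inj₁; inj₂)
open import Function using (_∘_)
open import Relation.Binary.PropositionalEquality
  using (_≢_; refl; sym; trans; cong; cong₂; subst; module ≡-Reasoning)
open import Relation.Nullary using (contradiction)

open ≡-Reasoning

sumFrom-+ : ∀ f a j k → sumFrom f a (j + k) ≡ sumFrom f a j + sumFrom f (a + j) k
sumFrom-+ f a zero    k rewrite +-identityʳ a = refl
sumFrom-+ f a (suc j) k rewrite sumFrom-+ f (suc a) j k | +-suc a j =
  sym (+-assoc (f a) _ _)

sumFromℤ-+ : ∀ f a j k →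
  sumFromℤ f a (j + k) ≡ sumFromℤ f a j ℤ.+ sumFromℤ f (a + j) k
sumFromℤ-+ f a zero    k rewrite +-identityʳ a = sym (ℤ.+-identityˡ _)
sumFromℤ-+ f a (suc j) k rewrite sumFromℤ-+ f (suc a) j k | +-suc a j =
  sym (ℤ.+-assoc (f a) _ _)

∸-split : ∀ {a b c} → a ≤ b → b ≤ c → c ∸ a ≡ (b ∸ a) + (c ∸ b)
∸-split {a} {b} {c} a≤b b≤c = begin
  c ∸ a                             ≡⟨ cong (_∸ a) (sym a+[b∸a]+[c∸b]≡c) ⟩
  a + ((b ∸ a) + (c ∸ b)) ∸ a       ≡⟨ m+n∸m≡n a _ ⟩
  (b ∸ a) + (c ∸ b)                 ∎
  where
  a+[b∸a]+[c∸b]≡c : a + ((b ∸ a) + (c ∸ b)) ≡ c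
  a+[b∸a]+[c∸b]≡c = begin
    a + ((b ∸ a) + (c ∸ b))   ≡⟨ sym (+-assoc a _ _) ⟩
    a + (b ∸ a) + (c ∸ b)     ≡⟨ cong (_+ (c ∸ b)) (m+[n∸m]≡n a≤b) ⟩
    b + (c ∸ b)               ≡⟨ m+[n∸m]≡n b≤c ⟩
    c                         ∎

Σℕ-split : ∀ f {a b c} → a ≤ suc b → b ≤ c →
  Σℕ a c f ≡ Σℕ a b f + Σℕ (suc b) c f
Σℕ-split f {a} {b} {c} a≤1+b b≤c rewrite ∸-split a≤1+b (s≤s b≤c) =
  trans (sumFrom-+ f a (suc b ∸ a) (c ∸ b))
        (cong (λ a′ → Σℕ a b f + sumFrom f a′ (c ∸ b)) (m+[n∸m]≡n a≤1+b))

Σℤ-split : ∀ f {a b c} → a ≤ suc b → b ≤ c →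
  Σℤ a c f ≡ Σℤ a b f ℤ.+ Σℤ (suc b) c f
Σℤ-split f {a} {b} {c} a≤1+b b≤c rewrite ∸-split a≤1+b (s≤s b≤c) =
  trans (sumFromℤ-+ f a (suc b ∸ a) (c ∸ b))
        (cong (λ a′ → Σℤ a b f ℤ.+ sumFromℤ f a′ (c ∸ b)) (m+[n∸m]≡n a≤1+b))

Σℕ-singleton : ∀ f a → Σℕ a a f ≡ f a
Σℕ-singleton f a rewrite m+n∸n≡m 1 a = +-identityʳ (f a)

Σℤ-empty : ∀ f {a b} → b < a → Σℤ a b f ≡ + 0
Σℤ-empty f b<a rewrite m≤n⇒m∸n≡0 b<a = refl

sumFromℤ-last : ∀ f a k → (∀ r → a ≤ r → r < a + k → f r ≡ + 0) →
  sumFromℤ f a (suc k) ≡ f (a + k)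
sumFromℤ-last f a zero    _ rewrite +-identityʳ a = ℤ.+-identityʳ (f a)
sumFromℤ-last f a (suc k) f≡0 rewrite f≡0 a ≤-refl (m<m+n a z<s) | +-suc a k =
  trans (ℤ.+-identityˡ _)
        (sumFromℤ-last f (suc a) k (λ r 1+a≤r → f≡0 r (<⇒≤ 1+a≤r)))

Σℤ-last : ∀ f {a b} → a ≤ b → (∀ r → a ≤ r → r < b → f r ≡ + 0) → Σℤ a b f ≡ f b
Σℤ-last f {a} {b} a≤b f≡0 = begin
  sumFromℤ f a (suc b ∸ a)    ≡⟨ cong (sumFromℤ f a) (+-∸-assoc 1 a≤b) ⟩
  sumFromℤ f a (suc (b ∸ a))  ≡⟨ sumFromℤ-last f a (b ∸ a) f≡0-below ⟩
  f (a + (b ∸ a))             ≡⟨ cong f (m+[n∸m]≡n a≤b) ⟩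
  f b                         ∎
  where
  f≡0-below : ∀ r → a ≤ r → r < a + (b ∸ a) → f r ≡ + 0
  f≡0-below r a≤r r<b = f≡0 r a≤r (subst (r <_) (m+[n∸m]≡n a≤b) r<b)

m+n-m≡n : ∀ (m n : ℤ) → m ℤ.+ n ℤ.- m ≡ n
m+n-m≡n = solve-∀

lastArgmaxFrom-≥ : ∀ f a k → a ≤ lastArgmaxFrom f a k
lastArgmaxFrom-≥ f a zero    = ≤-refl
lastArgmaxFrom-≥ f a (suc k) with f (lastArgmaxFrom f a k) ≤ᵇ f (a + suc k)
... | true  = m≤m+n a (suc k)
... | false = lastArgmaxFrom-≥ f a k

lastArgmaxFrom-≤ : ∀ f a k → lastArgmaxFrom f a k ≤ a + k
lastArgmaxFrom-≤ f a zero rewrite +-identityʳ a = ≤-refl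
lastArgmaxFrom-≤ f a (suc k) with f (lastArgmaxFrom f a k) ≤ᵇ f (a + suc k)
... | true  = ≤-refl
... | false = ≤-trans (lastArgmaxFrom-≤ f a k) (+-monoʳ-≤ a (n≤1+n k))

maxFrom≡f[lastArgmaxFrom] : ∀ f a k → maxFrom f a k ≡ f (lastArgmaxFrom f a k)
maxFrom≡f[lastArgmaxFrom] f a zero = refl
maxFrom≡f[lastArgmaxFrom] f a (suc k) rewrite maxFrom≡f[lastArgmaxFrom] f a k
  with f (lastArgmaxFrom f a k) ≤ᵇ f (a + suc k) in eq
... | true  = m≤n⇒m⊔n≡n (≤ᵇ⇒≤ _ _ (subst T (sym eq) _))
... | false = m≥n⇒m⊔n≡m (≰⇒≥ (subst T eq ∘ ≤⇒≤ᵇ))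

lastArgmax-≥ : ∀ a b f → a ≤ lastArgmax a b f
lastArgmax-≥ a b f = lastArgmaxFrom-≥ f a (b ∸ a)

lastArgmax-≤ : ∀ {a b} f → a ≤ b → lastArgmax a b f ≤ b
lastArgmax-≤ {a} {b} f a≤b =
  subst (lastArgmax a b f ≤_) (m+[n∸m]≡n a≤b) (lastArgmaxFrom-≤ f a (b ∸ a))

maxRange≡f[lastArgmax] : ∀ a b f → maxRange a b f ≡ f (lastArgmax a b f)
maxRange≡f[lastArgmax] a b f = maxFrom≡f[lastArgmaxFrom] f a (b ∸ a)

module _ (n i : ℕ) (A : Array) (s : ℕ) where

  rA<rA-suc : ∀ k → rA n i A s k < rA n i A s (suc k)
  rA<rA-suc k = lastArgmax-≥ (suc (rA n i A s k)) n (S n i A s)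

  rA-mono : ∀ {k l} → k ≤ l → rA n i A s k ≤ rA n i A s l
  rA-mono k≤l = mono′ (≤⇒≤′ k≤l)
    where
    mono′ : ∀ {k l} → k ≤′ l → rA n i A s k ≤ rA n i A s l
    mono′ ≤′-refl                    = ≤-refl
    mono′ {l = suc l} (≤′-step k≤′l) = ≤-trans (mono′ k≤′l) (<⇒≤ (rA<rA-suc l))

  rA0<i : 1 ≤ i → rA n i A s 0 < i
  rA0<i = ∸-monoʳ-< z<s

  i≤1+rA : ∀ k → i ≤ suc (rA n i A s k)
  i≤1+rA k = ≤-trans (m≤n+m∸n i 1) (s≤s (rA-mono {l = k} z≤n))

  M≡S[rA1] : 1 ≤ i → M n i A s ≡ S n i A s (rA n i A s 1)
  M≡S[rA1] 1≤i = begin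
    M n i A s                           ≡⟨ maxRange≡f[lastArgmax] i n Sₛ ⟩
    Sₛ (lastArgmax i n Sₛ)              ≡⟨ cong (λ a → Sₛ (lastArgmax a n Sₛ)) (m+[n∸m]≡n 1≤i) ⟨
    Sₛ (lastArgmax (suc (i ∸ 1)) n Sₛ)  ∎
    where Sₛ = S n i A s

  φ≡M-S[n]+a : i ≤ n → φ n i A s ≡ (+ M n i A s ℤ.- + S n i A s n) ℤ.+ + A (suc s) n
  φ≡M-S[n]+a i≤n = sym (begin
    (+ M n i A s ℤ.- + S n i A s n) ℤ.+ + W    ≡⟨ cong₂ (λ u v → (+ u ℤ.- + v) ℤ.+ + W) M≡X+Y S[n]≡X+Z+W ⟩
    (+ (X + Y) ℤ.- + (X + Z + W)) ℤ.+ + W      ≡⟨ cancel X Y Z W ⟩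
    + Y ℤ.- + Z                                ∎)
    where
    a₀ a₁ : ℕ → ℕ
    a₀ = A s
    a₁ = A (suc s)
    p = pMinus n i A s
    X = Σℕ i p a₀
    Y = Σℕ p n a₁
    Z = Σℕ (suc p) n a₀
    W = a₁ n
    -- U and S are the same function, so p is also the last maximiser of S.
    M≡X+Y : M n i A s ≡ X + Y
    M≡X+Y = maxRange≡f[lastArgmax] i n (S n i A s)
    S[n]≡X+Z+W : S n i A s n ≡ X + Z + W
    S[n]≡X+Z+W = cong₂ _+_
      (Σℕ-split a₀ (≤-trans (lastArgmax-≥ i n (U n i A s)) (n≤1+n p))
                   (lastArgmax-≤ (U n i A s) i≤n))
      (Σℕ-singleton a₁ n)
    cancelℤ : ∀ (x y z w : ℤ) → (x ℤ.+ y ℤ.- (x ℤ.+ z ℤ.+ w)) ℤ.+ w ≡ y ℤ.- z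
    cancelℤ = solve-∀
    cancel : ∀ x y z w → (+ (x + y) ℤ.- + (x + z + w)) ℤ.+ + w ≡ + y ℤ.- + z
    cancel x y z w rewrite ℤ.pos-+ x y | ℤ.pos-+ (x + z) w | ℤ.pos-+ x z =
      cancelℤ (+ x) (+ y) (+ z) (+ w)

module _ {n i : ℕ} {A : Array} {s l : ℕ} {x : ℕ → ℤ}
         (isX : IsXA n i A s (suc l) x) (rA≡n : rA n i A s (suc l) ≡ n) where
  open IsXA isX

  rA<n : rA n i A s l < n
  rA<n = subst (rA n i A s l <_) rA≡n (rA<rA-suc n i A s l)

  x≡0-after-rA : ∀ r → rA n i A s l < r → r < n → x r ≡ + 0
  x≡0-after-rA r rA<r r<n = offSeq r (≤-trans (i≤1+rA n i A s l) rA<r) (<⇒≤ r<n) r≢rA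
    where
    r≢rA : ∀ k → 1 ≤ k → k ≤ suc l → r ≢ rA n i A s k
    r≢rA k _ k≤1+l r≡rA with m≤n⇒m<n∨m≡n k≤1+l
    ... | inj₁ (s≤s k≤l) = <⇒≢ (≤-<-trans (rA-mono n i A s k≤l) rA<r) (sym r≡rA)
    ... | inj₂ refl      = <⇒≢ r<n (trans r≡rA rA≡n)

  xA-suffix-sum : Σℤ (suc (rA n i A s l)) n x ≡ + A (suc s) n
  xA-suffix-sum = trans (Σℤ-last x rA<n x≡0-after-rA) atN

xA-prefix-sum : ∀ {n i A s l x} → 1 ≤ i → IsXA n i A s (suc l) x → rA n i A s (suc l) ≡ n →
  Σℤ i (rA n i A s l) x ≡ + M n i A s ℤ.- + S n i A s n
xA-prefix-sum {n} {i} {A} {s} {zero} {x} 1≤i _ rA≡n = begin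
  Σℤ i (i ∸ 1) x                       ≡⟨ Σℤ-empty x (rA0<i n i A s 1≤i) ⟩
  + 0                                  ≡⟨ sym (ℤ.+-inverseʳ (+ S n i A s n)) ⟩
  + S n i A s n ℤ.- + S n i A s n      ≡⟨ cong (λ m → + m ℤ.- + S n i A s n) (sym M≡S[n]) ⟩
  + M n i A s ℤ.- + S n i A s n        ∎
  where
  M≡S[n] : M n i A s ≡ S n i A s n
  M≡S[n] = trans (M≡S[rA1] n i A s 1≤i) (cong (S n i A s) rA≡n)
xA-prefix-sum {n} {i} {A} {s} {suc l} {x} _ isX rA≡n = begin
  Σ                         ≡⟨ m+n-m≡n (+ S n i A s n) Σ ⟨
  + S n i A s n ℤ.+ Σ ℤ.- + S n i A s n
    ≡⟨ cong (λ r → + S n i A s r ℤ.+ Σ ℤ.- + S n i A s n) rA≡n ⟨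
  + S n i A s (rA n i A s (suc (suc l))) ℤ.+ Σ ℤ.- + S n i A s n
    ≡⟨ cong (ℤ._- + S n i A s n) (IsXA.recur isX (suc l) (s≤s z≤n) ≤-refl) ⟩
  + M n i A s ℤ.- + S n i A s n ∎
  where Σ = Σℤ i (rA n i A s (suc l)) x

corollary2p5 : (n i m : ℕ) (A : Array) (s : ℕ) →
    1 ≤ n → 1 ≤ i → i ≤ n → 1 ≤ m → InB n i m A → 1 ≤ s → s < i →
    (ℓ : ℕ) → rA n i A s ℓ ≡ n →
    (x : ℕ → ℤ) → IsXA n i A s ℓ x →
    Σℤ i n x ≡ φ n i A s
corollary2p5 n i _ A s _ 1≤i i≤n _ _ _ _ zero rA≡n _ _ =
  contradiction rA≡n (<⇒≢ (<-≤-trans (rA0<i n i A s 1≤i) i≤n))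
corollary2p5 n i _ A s _ 1≤i i≤n _ _ _ _ (suc l) rA≡n x isX = begin
  Σℤ i n x
    ≡⟨ Σℤ-split x (i≤1+rA n i A s l) (<⇒≤ (rA<n isX rA≡n)) ⟩
  Σℤ i (rA n i A s l) x ℤ.+ Σℤ (suc (rA n i A s l)) n x
    ≡⟨ cong₂ ℤ._+_ (xA-prefix-sum 1≤i isX rA≡n) (xA-suffix-sum isX rA≡n) ⟩
  (+ M n i A s ℤ.- + S n i A s n) ℤ.+ + A (suc s) n
    ≡⟨ φ≡M-S[n]+a n i A s i≤n ⟨
  φ n i A s ∎
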